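{- Let $2<p<q$ be primes. Let $c_{pq,k}$ denote the coefficient of $X^k$ in the cyclotomic polynomial $\Phi_{pq}(X)$, and let $S_{pq}^+=\{k: c_{pq,k}>0\}$ and $S_{pq}^-=\{k: c_{pq,k}<0\}$. Then: (i) $S_{pq}^+$ is in arithmetic progression if and only if $q = mp+1$ for some positive integer $m$. (ii) $S_{pq}^-$ is in arithmetic progression if and only if $q=mp-1$ for some positive integer $m$.
   Context: $\Phi_n(X)=\prod_{1\le m\le n,\ \gcd(m,n)=1}(X-e^{2\pi i m/n})\in\mathbb{Z}[X]$ is the $n$-th cyclotomic polynomial. A finite set of integers is said to be in arithmetic progression if, when its elements are listed in increasing order, consecutive differences are all equal. -}

module Defs where

open import Data.Nat as ℕ using (ℕ; zero; suc; _∸_; _<_)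
open import Data.Nat.Divisibility using (_∣?_)
open import Data.Integer as ℤ using (ℤ; +_; -[1+_])
open import Data.List using (List; []; _∷_; _++_; replicate; length; zipWith; foldr; reverse; map)
open import Data.List.Membership.Propositional using (_∈_)
open import Data.List.Relation.Unary.Linked using (Linked)
open import Data.Product using (Σ; _×_; ∃-syntax)
open import Function.Bundles using (_⇔_)
open import Relation.Binary.PropositionalEquality using (_≡_)
open import Relation.Nullary.Decidable using (does)
open import Data.Bool using (if_then_else_)

-- Integer polynomials as coefficient lists, lowest degree first.
Poly : Set
Poly = List ℤ

coeff : Poly → ℕ → ℤ
coeff []      _       = + 0
coeff (a ∷ _) zero    = a
coeff (_ ∷ f) (suc k) = coeff f k

addP : Poly → Poly → Poly
addP []      g       = g
addP f       []      = f
addP (a ∷ f) (b ∷ g) = (a ℤ.+ b) ∷ addP f g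

mulP : Poly → Poly → Poly
mulP []      g = []
mulP (a ∷ f) g = addP (map (a ℤ.*_) g) (+ 0 ∷ mulP f g)

-- X^n - 1 for n = suc k
xPowMinusOne : ℕ → Poly
xPowMinusOne k = -[1+ 0 ] ∷ (replicate k (+ 0) ++ (+ 1 ∷ []))

sumℤ : List ℤ → ℤ
sumℤ = foldr ℤ._+_ (+ 0)

-- Exact division a / g where g has constant term ±1 (power-series division,
-- keeping the first (length a ∸ length g + 1) coefficients of the quotient).
-- go i returns [q_{i-1}, ..., q_0].
divGo : Poly → ℤ → Poly → ℕ → List ℤ
divGo a g0 gt zero    = []
divGo a g0 gt (suc i) =
  let r = divGo a g0 gt i in
  (g0 ℤ.* (coeff a i ℤ.- sumℤ (zipWith ℤ._*_ gt r))) ∷ r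

divExact : Poly → Poly → Poly
divExact a []        = []
divExact a (g0 ∷ gt) = reverse (divGo a g0 gt (suc (length a ∸ suc (length gt))))

-- table k = [(k , Φ_k) , ... , (1 , Φ_1)]
-- defined by the standard recursion  X^n - 1 = ∏_{d ∣ n} Φ_d(X)
mutual
  table : ℕ → List (Σ ℕ (λ _ → Poly))
  table zero    = []
  table (suc k) = (suc k Data.Product., cycloSuc k) ∷ table k

  divProd : ℕ → List (Σ ℕ (λ _ → Poly)) → Poly
  divProd n []                          = + 1 ∷ []
  divProd n ((d Data.Product., f) ∷ t) =
    if does (d ∣? n) then mulP f (divProd n t) else divProd n t

  cycloSuc : ℕ → Poly
  cycloSuc k = divExact (xPowMinusOne k) (divProd (suc k) (table k))

-- the n-th cyclotomic polynomial (n ≥ 1; Φ_0 is a junk value)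
cyclotomic : ℕ → Poly
cyclotomic zero    = []
cyclotomic (suc k) = cycloSuc k

cycCoeff : ℕ → ℕ → ℤ
cycCoeff n k = coeff (cyclotomic n) k

Splus : ℕ → ℕ → Set
Splus n k = + 0 ℤ.< cycCoeff n k

Sminus : ℕ → ℕ → Set
Sminus n k = cycCoeff n k ℤ.< + 0

InArithProg : (ℕ → Set) → Set
InArithProg S =
  ∃[ xs ] ∃[ d ]
    ((∀ k → (S k ⇔ k ∈ xs)) ×
     Linked (λ x y → x < y × y ≡ x ℕ.+ d) xs)

{-# OPTIONS --safe #-}
module Submission where

-- Dividing X^pq - 1 = Φ₁ Φ_p Φ_q Φ_pq by Φ₁ Φ_p Φ_q as power series, with Φ_r = 1 + X + … + X^(r-1)
-- for r prime, gives Φ_pq = (1 - X) Σ_{j ∈ S} X^j up to degree (p-1)(q-1), where S is the semigroup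
-- generated by p and q: below pq every element of S is ip + lq in exactly one way, so
-- (1 - X^p) (1 - X^q) Σ_{j ∈ S} X^j ≡ 1 modulo X^pq.  Hence c_k > 0 iff k ∈ S and k - 1 ∉ S,
-- and c_k < 0 iff k ∉ S and k - 1 ∈ S.
--
-- So S⁺ contains 0 and p, and S⁻ contains 1 and 1 + p (as q ≠ p + 1).  If q - 1 ∉ S then also q ∈ S⁺,
-- and if q + 1 ∉ S then also 1 + q ∈ S⁻; but a progression starting at a and containing a + p and a + q
-- has step 1, while 1 ∉ S⁺ and 2 ∉ S⁻.  Hence q - 1, resp. q + 1, lies in S and is a multiple of p.
-- Conversely, if q = mp + 1 then S⁺ consists of the multiples tp up to the degree, and if q = mp - 1
-- then S⁻ consists of the numbers tp + 1 up to the degree: writing tp - 1, resp. tp + 1, as ip + lq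
-- would force l ≡ -1 (mod p), hence ip + lq ≥ (p-1)q, which exceeds the degree.

open import Defs

module PowerSeries where

  open import Data.Nat as ℕ using (ℕ; zero; suc; _∸_; s≤s)
  import Data.Nat.Properties as ℕₚ
  open import Data.Integer using (ℤ; +_; -[1+_]; _+_; _*_; -_; _-_)
  open import Data.Integer.Properties
  open import Data.Integer.Tactic.RingSolver using (solve-∀)
  open import Data.List using ([]; _∷_; map; zipWith; reverse; replicate; length; applyUpTo; applyDownFrom)
  open import Data.List.Properties using (reverse-applyDownFrom; length-map; length-replicate)
  open import Relation.Binary.PropositionalEquality
  open import Function using (_∘_)

  infixl 7 _⊛_

  -- (f ⊛ h) i is the coefficient of X^i in the product of the polynomial f with the power series h.
  _⊛_ : Poly → (ℕ → ℤ) → ℕ → ℤ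
  ([]      ⊛ h) i       = + 0
  ((a ∷ f) ⊛ h) zero    = a * h 0
  ((a ∷ f) ⊛ h) (suc i) = a * h (suc i) + (f ⊛ h) i

  ⊛-congʳ : ∀ f {h h′} → h ≗ h′ → f ⊛ h ≗ f ⊛ h′
  ⊛-congʳ []      h≗h′ i       = refl
  ⊛-congʳ (a ∷ f) h≗h′ zero    = cong (a *_) (h≗h′ 0)
  ⊛-congʳ (a ∷ f) h≗h′ (suc i) = cong₂ _+_ (cong (a *_) (h≗h′ (suc i))) (⊛-congʳ f h≗h′ i)

  ⊛-neg : ∀ f h → f ⊛ (-_ ∘ h) ≗ -_ ∘ (f ⊛ h)
  ⊛-neg []      h i       = refl
  ⊛-neg (a ∷ f) h zero    = sym (neg-distribʳ-* a (h 0))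
  ⊛-neg (a ∷ f) h (suc i) = begin
    a * - h (suc i) + (f ⊛ (-_ ∘ h)) i ≡⟨ cong₂ _+_ (sym (neg-distribʳ-* a (h (suc i)))) (⊛-neg f h i) ⟩
    - (a * h (suc i)) + - (f ⊛ h) i    ≡⟨ neg-distrib-+ (a * h (suc i)) ((f ⊛ h) i) ⟨
    - (a * h (suc i) + (f ⊛ h) i)      ∎
    where open ≡-Reasoning

  ⊛-addP : ∀ f g h i → (addP f g ⊛ h) i ≡ (f ⊛ h) i + (g ⊛ h) i
  ⊛-addP []      g       h i       = sym (+-identityˡ _)
  ⊛-addP (a ∷ f) []      h i       = sym (+-identityʳ _)
  ⊛-addP (a ∷ f) (b ∷ g) h zero    = *-distribʳ-+ (h 0) a b
  ⊛-addP (a ∷ f) (b ∷ g) h (suc i) = begin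
    (a + b) * x + (addP f g ⊛ h) i      ≡⟨ cong₂ _+_ (*-distribʳ-+ x a b) (⊛-addP f g h i) ⟩
    (a * x + b * x) + (u + v)           ≡⟨ regroup (a * x) (b * x) u v ⟩
    (a * x + u) + (b * x + v)           ∎
    where
    open ≡-Reasoning
    x u v : ℤ
    x = h (suc i)
    u = (f ⊛ h) i
    v = (g ⊛ h) i
    regroup : ∀ w x y z → (w + x) + (y + z) ≡ (w + y) + (x + z)
    regroup = solve-∀

  ⊛-scale : ∀ a g h → map (a *_) g ⊛ h ≗ (a *_) ∘ (g ⊛ h)
  ⊛-scale a []      h i       = sym (*-zeroʳ a)
  ⊛-scale a (b ∷ g) h zero    = *-assoc a b (h 0)
  ⊛-scale a (b ∷ g) h (suc i) = begin
    a * b * h (suc i) + (map (a *_) g ⊛ h) i ≡⟨ cong₂ _+_ (*-assoc a b (h (suc i))) (⊛-scale a g h i) ⟩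
    a * (b * h (suc i)) + a * (g ⊛ h) i      ≡⟨ *-distribˡ-+ a _ _ ⟨
    a * (b * h (suc i) + (g ⊛ h) i)          ∎
    where open ≡-Reasoning

  mulP-⊛ : ∀ f g h → mulP f g ⊛ h ≗ f ⊛ (g ⊛ h)
  mulP-⊛ []      g h i       = refl
  mulP-⊛ (a ∷ f) g h zero    = begin
    (addP (map (a *_) g) (+ 0 ∷ mulP f g) ⊛ h) 0 ≡⟨ ⊛-addP (map (a *_) g) (+ 0 ∷ mulP f g) h 0 ⟩
    (map (a *_) g ⊛ h) 0 + + 0 * h 0             ≡⟨ cong₂ _+_ (⊛-scale a g h 0) (*-zeroˡ (h 0)) ⟩
    a * (g ⊛ h) 0 + + 0                          ≡⟨ +-identityʳ _ ⟩
    a * (g ⊛ h) 0                                ∎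
    where open ≡-Reasoning
  mulP-⊛ (a ∷ f) g h (suc i) = begin
    (addP (map (a *_) g) (+ 0 ∷ mulP f g) ⊛ h) (suc i)    ≡⟨ ⊛-addP (map (a *_) g) (+ 0 ∷ mulP f g) h (suc i) ⟩
    (map (a *_) g ⊛ h) (suc i) + (+ 0 * h (suc i) + (mulP f g ⊛ h) i)
      ≡⟨ cong₂ _+_ (⊛-scale a g h (suc i)) (+-identityˡ _) ⟩
    a * (g ⊛ h) (suc i) + (mulP f g ⊛ h) i                ≡⟨ cong (_+_ (a * (g ⊛ h) (suc i))) (mulP-⊛ f g h i) ⟩
    a * (g ⊛ h) (suc i) + (f ⊛ (g ⊛ h)) i                 ∎
    where open ≡-Reasoning

  ⊛-sum : ∀ f h j → (f ⊛ h) j ≡ sumℤ (zipWith _*_ f (applyDownFrom h (suc j)))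
  ⊛-sum []          h j       = refl
  ⊛-sum (a ∷ [])    h zero    = sym (+-identityʳ _)
  ⊛-sum (a ∷ b ∷ f) h zero    = sym (+-identityʳ _)
  ⊛-sum (a ∷ f)     h (suc j) = cong (_+_ (a * h (suc j))) (⊛-sum f h j)

  quotientLength : Poly → Poly → ℕ
  quotientLength a g = suc (length a ∸ length g)

  divGo-applyDownFrom : ∀ a g₀ g h {n} → g₀ * g₀ ≡ + 1 →
    (∀ j → j ℕ.< n → coeff a j ≡ ((g₀ ∷ g) ⊛ h) j) →
    ∀ i → i ℕ.≤ n → divGo a g₀ g i ≡ applyDownFrom h i
  divGo-applyDownFrom a g₀ g h unit a≡gh zero    _   = refl
  divGo-applyDownFrom a g₀ g h unit a≡gh (suc i) i<n =
    cong₂ _∷_ next (divGo-applyDownFrom a g₀ g h unit a≡gh i (ℕₚ.<⇒≤ i<n))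
    where
    open ≡-Reasoning
    s : ℤ
    s = sumℤ (zipWith _*_ g (applyDownFrom h i))
    cancel : ∀ u x s → u * (u * x + s - s) ≡ u * u * x
    cancel = solve-∀
    next : g₀ * (coeff a i - sumℤ (zipWith _*_ g (divGo a g₀ g i))) ≡ h i
    next = begin
      g₀ * (coeff a i - sumℤ (zipWith _*_ g (divGo a g₀ g i)))
        ≡⟨ cong (λ r → g₀ * (coeff a i - sumℤ (zipWith _*_ g r))) (divGo-applyDownFrom a g₀ g h unit a≡gh i (ℕₚ.<⇒≤ i<n)) ⟩
      g₀ * (coeff a i - s)      ≡⟨ cong (λ c → g₀ * (c - s)) (trans (a≡gh i i<n) (⊛-sum (g₀ ∷ g) h i)) ⟩
      g₀ * (g₀ * h i + s - s)   ≡⟨ cancel g₀ (h i) s ⟩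
      g₀ * g₀ * h i             ≡⟨ cong (_* h i) unit ⟩
      + 1 * h i                 ≡⟨ *-identityˡ (h i) ⟩
      h i                       ∎

  divExact-correct : ∀ a g h → coeff g 0 * coeff g 0 ≡ + 1 →
    (∀ j → j ℕ.< quotientLength a g → coeff a j ≡ (g ⊛ h) j) →
    divExact a g ≡ applyUpTo h (quotientLength a g)
  divExact-correct a []       h () a≡gh
  divExact-correct a (g₀ ∷ g) h unit a≡gh = begin
    reverse (divGo a g₀ g n)   ≡⟨ cong reverse (divGo-applyDownFrom a g₀ g h unit a≡gh n ℕₚ.≤-refl) ⟩
    reverse (applyDownFrom h n) ≡⟨ reverse-applyDownFrom h n ⟩
    applyUpTo h n               ∎
    where
    open ≡-Reasoning
    n : ℕ
    n = quotientLength a (g₀ ∷ g)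

  coeff-applyUpTo-< : ∀ h {n k} → k ℕ.< n → coeff (applyUpTo h n) k ≡ h k
  coeff-applyUpTo-< h {suc n} {zero}  _           = refl
  coeff-applyUpTo-< h {suc n} {suc k} (s≤s k<n) = coeff-applyUpTo-< (h ∘ suc) k<n

  coeff-applyUpTo-≥ : ∀ h {n k} → n ℕ.≤ k → coeff (applyUpTo h n) k ≡ + 0
  coeff-applyUpTo-≥ h {zero}  _         = refl
  coeff-applyUpTo-≥ h {suc n} (s≤s n≤k) = coeff-applyUpTo-≥ (h ∘ suc) n≤k

  -- shift m F is X^m F.
  shift : ℕ → (ℕ → ℤ) → ℕ → ℤ
  shift zero    F i       = F i
  shift (suc m) F zero    = + 0
  shift (suc m) F (suc i) = shift m F i

  diff : (ℕ → ℤ) → ℕ → ℤ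
  diff F j = F j - shift 1 F j

  shift-+ : ∀ m F k → shift m F (m ℕ.+ k) ≡ F k
  shift-+ zero    F k = refl
  shift-+ (suc m) F k = shift-+ m F k

  shift-< : ∀ m F {j} → j ℕ.< m → shift m F j ≡ + 0
  shift-< (suc m) F {zero}  _         = refl
  shift-< (suc m) F {suc j} (s≤s j<m) = shift-< m F j<m

  shift-shift : ∀ m n F → shift m (shift n F) ≗ shift (m ℕ.+ n) F
  shift-shift zero    n F i       = refl
  shift-shift (suc m) n F zero    = refl
  shift-shift (suc m) n F (suc i) = shift-shift m n F i

  shift-distrib-sub : ∀ m F G → shift m (λ j → F j - G j) ≗ λ j → shift m F j - shift m G j
  shift-distrib-sub zero    F G i       = refl
  shift-distrib-sub (suc m) F G zero    = refl
  shift-distrib-sub (suc m) F G (suc i) = shift-distrib-sub m F G i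

  replicate-⊛-diff : ∀ m F → replicate m (+ 1) ⊛ diff F ≗ λ j → F j - shift m F j
  replicate-⊛-diff zero    F i       = sym (+-inverseʳ (F i))
  replicate-⊛-diff (suc m) F zero    = *-identityˡ _
  replicate-⊛-diff (suc m) F (suc i) = begin
    + 1 * diff F (suc i) + (replicate m (+ 1) ⊛ diff F) i ≡⟨ cong₂ _+_ (*-identityˡ (diff F (suc i))) (replicate-⊛-diff m F i) ⟩
    (F (suc i) - F i) + (F i - shift m F i)              ≡⟨ telescope (F (suc i)) (F i) (shift m F i) ⟩
    F (suc i) - shift m F i                              ∎
    where
    open ≡-Reasoning
    telescope : ∀ x y z → (x - y) + (y - z) ≡ x - z
    telescope = solve-∀

  Φ₁ : Poly
  Φ₁ = -[1+ 0 ] ∷ + 1 ∷ []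

  Φ₁-⊛ : ∀ h → Φ₁ ⊛ h ≗ -_ ∘ diff h
  Φ₁-⊛ h zero    = lemma (h 0)
    where
    lemma : ∀ x → -[1+ 0 ] * x ≡ - (x - + 0)
    lemma = solve-∀
  Φ₁-⊛ h (suc zero) = lemma (h 1) (h 0)
    where
    lemma : ∀ x y → -[1+ 0 ] * x + + 1 * y ≡ - (x - y)
    lemma = solve-∀
  Φ₁-⊛ h (suc (suc i)) = lemma (h (2 ℕ.+ i)) (h (suc i))
    where
    lemma : ∀ x y → -[1+ 0 ] * x + (+ 1 * y + + 0) ≡ - (x - y)
    lemma = solve-∀

  doubleDiff : ℕ → ℕ → (ℕ → ℤ) → ℕ → ℤ
  doubleDiff p q F j = (F j - shift p F j) - (shift q F j - shift (q ℕ.+ p) F j)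

  diff-commutes-with-shift : ∀ p F → (λ j → diff F j - shift p (diff F) j) ≗ diff (λ j → F j - shift p F j)
  diff-commutes-with-shift p F i = begin
    (F i - shift 1 F i) - shift p (λ j → F j - shift 1 F j) i
      ≡⟨ cong (_-_ (F i - shift 1 F i)) (trans (shift-distrib-sub p F (shift 1 F) i) (cong (_-_ (shift p F i)) (shift-shift p 1 F i))) ⟩
    (F i - shift 1 F i) - (shift p F i - shift (p ℕ.+ 1) F i)
      ≡⟨ cong (λ m → (F i - shift 1 F i) - (shift p F i - shift m F i)) (ℕₚ.+-comm p 1) ⟩
    (F i - shift 1 F i) - (shift p F i - shift (1 ℕ.+ p) F i)
      ≡⟨ swap (F i) (shift 1 F i) (shift p F i) (shift (1 ℕ.+ p) F i) ⟩
    (F i - shift p F i) - (shift 1 F i - shift (1 ℕ.+ p) F i)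
      ≡⟨ cong (_-_ (F i - shift p F i)) (trans (shift-distrib-sub 1 F (shift p F) i) (cong (_-_ (shift 1 F i)) (shift-shift 1 p F i))) ⟨
    (F i - shift p F i) - shift 1 (λ j → F j - shift p F j) i ∎
    where
    open ≡-Reasoning
    swap : ∀ a b c d → (a - b) - (c - d) ≡ (a - c) - (b - d)
    swap = solve-∀

  ones-ones-Φ₁-⊛-diff : ∀ p q F →
    replicate q (+ 1) ⊛ (replicate p (+ 1) ⊛ (Φ₁ ⊛ diff F)) ≗ -_ ∘ doubleDiff p q F
  ones-ones-Φ₁-⊛-diff p q F j = begin
    (Rq ⊛ (Rp ⊛ (Φ₁ ⊛ diff F))) j  ≡⟨ ⊛-congʳ Rq (⊛-congʳ Rp (Φ₁-⊛ (diff F))) j ⟩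
    (Rq ⊛ (Rp ⊛ (-_ ∘ ΔΔF))) j     ≡⟨ ⊛-congʳ Rq (⊛-neg Rp ΔΔF) j ⟩
    (Rq ⊛ (-_ ∘ (Rp ⊛ ΔΔF))) j     ≡⟨ ⊛-neg Rq (Rp ⊛ ΔΔF) j ⟩
    - (Rq ⊛ (Rp ⊛ ΔΔF)) j          ≡⟨ cong -_ (⊛-congʳ Rq (λ i → trans (replicate-⊛-diff p (diff F) i) (diff-commutes-with-shift p F i)) j) ⟩
    - (Rq ⊛ diff G) j              ≡⟨ cong -_ (replicate-⊛-diff q G j) ⟩
    - (G j - shift q G j)          ≡⟨ cong (λ s → - (G j - s)) shift-G ⟩
    - doubleDiff p q F j           ∎
    where
    open ≡-Reasoning
    Rp Rq : Poly
    Rp = replicate p (+ 1)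
    Rq = replicate q (+ 1)
    ΔΔF G : ℕ → ℤ
    ΔΔF = diff (diff F)
    G j = F j - shift p F j
    shift-G : shift q G j ≡ shift q F j - shift (q ℕ.+ p) F j
    shift-G = trans (shift-distrib-sub q F (shift p F) j) (cong (_-_ (shift q F j)) (shift-shift q p F j))

  length-addP : ∀ f g → length (addP f g) ≡ length f ℕ.⊔ length g
  length-addP []      g       = refl
  length-addP (a ∷ f) []      = refl
  length-addP (a ∷ f) (b ∷ g) = cong suc (length-addP f g)

  length-mulP : ∀ a f g → 1 ℕ.≤ length g → length (mulP (a ∷ f) g) ≡ length f ℕ.+ length g
  length-mulP a []      (b ∷ g) _ = cong suc (trans (length-addP (map (a *_) g) []) (trans (ℕₚ.⊔-identityʳ _) (length-map (a *_) g)))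
  length-mulP a (c ∷ f) (b ∷ g) _ = begin
    length (addP (map (a *_) (b ∷ g)) (+ 0 ∷ mulP (c ∷ f) (b ∷ g))) ≡⟨ length-addP (map (a *_) (b ∷ g)) (+ 0 ∷ mulP (c ∷ f) (b ∷ g)) ⟩
    length (map (a *_) (b ∷ g)) ℕ.⊔ suc (length (mulP (c ∷ f) (b ∷ g)))
      ≡⟨ cong₂ (λ m n → m ℕ.⊔ suc n) (length-map (a *_) (b ∷ g)) (length-mulP c f (b ∷ g) (s≤s ℕ.z≤n)) ⟩
    suc (length g) ℕ.⊔ suc (length f ℕ.+ suc (length g))               ≡⟨ ℕₚ.m≤n⇒m⊔n≡n (ℕₚ.m≤n+m _ (suc (length f))) ⟩
    suc (length f ℕ.+ suc (length g))                                  ∎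
    where open ≡-Reasoning

  coeff-mulP-0 : ∀ f g → coeff (mulP f g) 0 ≡ coeff f 0 * coeff g 0
  coeff-mulP-0 []      g       = refl
  coeff-mulP-0 (a ∷ f) []      = sym (*-zeroʳ a)
  coeff-mulP-0 (a ∷ f) (b ∷ g) = +-identityʳ (a * b)

  length-replicate-mulP : ∀ {n} x g → 1 ℕ.≤ n → 1 ℕ.≤ length g → suc (length (mulP (replicate n x) g)) ≡ n ℕ.+ length g
  length-replicate-mulP {suc n} x g _ 1≤∣g∣ = cong suc (trans (length-mulP x (replicate n x) g 1≤∣g∣) (cong (ℕ._+ length g) (length-replicate n)))

  coeff-replicate-0 : ∀ {n} x → 1 ℕ.≤ n → coeff (replicate n x) 0 ≡ x
  coeff-replicate-0 {suc n} x _ = refl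

open PowerSeries

open import Data.Nat using (ℕ; zero; suc; pred; _+_; _*_; _∸_; _/_; _≤_; _<_; _≟_; _≤?_; z≤n; s≤s; NonZero; >-nonZero; >-nonZero⁻¹; nonTrivial⇒n>1)
open import Data.Nat.Properties
open import Data.Nat.DivMod using (m*n/n≡m; m/n*n≤m; /-monoˡ-≤)
open import Data.Nat.Divisibility using (_∣_; _∣?_; divides; m∣m*n; n∣m*n; 1∣_; ∣⇒≤; ∣1⇒≡1; ∣m+n∣m⇒∣n; ∣-refl)
open import Data.Nat.Coprimality using (Coprime; coprime-divisor; prime⇒coprime)
import Data.Nat.Coprimality as Coprime
open import Data.Nat.Primality using (Prime; prime⇒irreducible; euclidsLemma; prime⇒nonZero; prime⇒nonTrivial)
open import Data.Nat.Tactic.RingSolver using (solve-∀)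
open import Data.Integer as ℤ using (ℤ; +_; -[1+_]; +<+; -<+)
import Data.Integer.Properties as ℤₚ
open import Data.List using ([]; _∷_; length; replicate; applyUpTo)
open import Data.List.Membership.Propositional using (_∈_)
open import Data.List.Membership.Propositional.Properties using (∈-applyUpTo⁺; ∈-applyUpTo⁻)
open import Data.List.Relation.Unary.Any using (here; there)
open import Data.List.Relation.Unary.Linked using (Linked; _∷_)
open import Data.List.Relation.Unary.Linked.Properties using (applyUpTo⁺₂)
open import Data.Product using (∃-syntax; _×_; _,_; proj₁; proj₂)
open import Data.Sum using (_⊎_; inj₁; inj₂; [_,_]′)
open import Function using (_∘_; const)
open import Function.Bundles using (_⇔_; mk⇔; Equivalence)
open import Relation.Binary.PropositionalEquality
open import Relation.Nullary using (Dec; yes; no; ¬_; contradiction)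
open import Relation.Nullary.Decidable using (map′; dec-true; dec-false)

private
  variable
    n a d : ℕ

divProd-∤ : ∀ f t → ¬ d ∣ n → divProd n ((d , f) ∷ t) ≡ divProd n t
divProd-∤ {d} {n} f t d∤n rewrite dec-false (d ∣? n) d∤n = refl

divProd-∣ : ∀ f t → d ∣ n → divProd n ((d , f) ∷ t) ≡ mulP f (divProd n t)
divProd-∣ {d} {n} f t d∣n rewrite dec-true (d ∣? n) d∣n = refl

divProd-table-∣ : ∀ d .{{_ : NonZero d}} → d ∣ n → divProd n (table d) ≡ mulP (cyclotomic d) (divProd n (table (pred d)))
divProd-table-∣ (suc d) = divProd-∣ (cycloSuc d) (table d)

divProd-table-skip : ∀ k → a ≤ k → (∀ {d} → a < d → d ≤ k → ¬ d ∣ n) → divProd n (table k) ≡ divProd n (table a)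
divProd-table-skip zero    z≤n   _   = refl
divProd-table-skip (suc k) a≤1+k gap with m≤n⇒m<n∨m≡n a≤1+k
... | inj₂ refl      = refl
... | inj₁ (s≤s a≤k) = trans (divProd-∤ (cycloSuc k) (table k) (gap (s≤s a≤k) ≤-refl))
                             (divProd-table-skip k a≤k (λ a<d d≤k → gap a<d (m≤n⇒m≤1+n d≤k)))

divProd-table-gap : ∀ {b} .{{_ : NonZero b}} → a < b → (∀ {d} → a < d → d < b → ¬ d ∣ n) →
  divProd n (table (pred b)) ≡ divProd n (table a)
divProd-table-gap {b = b} a<b gap = divProd-table-skip (pred b) (<⇒≤pred a<b) (λ a<d d≤b-1 → gap a<d (m≤pred[n]⇒suc[m]≤n d≤b-1))

cyclotomic-nonZero : ∀ n .{{_ : NonZero n}} →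
  cyclotomic n ≡ divExact (xPowMinusOne (pred n)) (divProd n (table (pred n)))
cyclotomic-nonZero (suc n) = refl

applyUpTo-const : ∀ {A : Set} (x : A) n → applyUpTo (const x) n ≡ replicate n x
applyUpTo-const x zero    = refl
applyUpTo-const x (suc n) = cong (x ∷_) (applyUpTo-const x n)

coeff-xPowMinusOne : ∀ k {j} → j < k → coeff (xPowMinusOne k) (suc j) ≡ + 0
coeff-xPowMinusOne (suc k) {zero}  _         = refl
coeff-xPowMinusOne (suc k) {suc j} (s≤s j<k) = coeff-xPowMinusOne k j<k

length-xPowMinusOne : ∀ k → length (xPowMinusOne k) ≡ suc (suc k)
length-xPowMinusOne zero    = refl
length-xPowMinusOne (suc k) = cong suc (length-xPowMinusOne k)

divExact-xPowMinusOne-Φ₁ : ∀ k → divExact (xPowMinusOne k) Φ₁ ≡ replicate (suc k) (+ 1)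
divExact-xPowMinusOne-Φ₁ k = begin
  divExact (xPowMinusOne k) Φ₁                       ≡⟨ divExact-correct (xPowMinusOne k) Φ₁ (const (+ 1)) refl agree ⟩
  applyUpTo (const (+ 1)) (quotientLength (xPowMinusOne k) Φ₁) ≡⟨ cong (applyUpTo (const (+ 1))) length-quotient ⟩
  applyUpTo (const (+ 1)) (suc k)                    ≡⟨ applyUpTo-const (+ 1) (suc k) ⟩
  replicate (suc k) (+ 1)                            ∎
  where
  open ≡-Reasoning
  length-quotient : quotientLength (xPowMinusOne k) Φ₁ ≡ suc k
  length-quotient = cong (λ m → suc (m ∸ 2)) (length-xPowMinusOne k)
  agree : ∀ j → j < quotientLength (xPowMinusOne k) Φ₁ → coeff (xPowMinusOne k) j ≡ (Φ₁ ⊛ const (+ 1)) j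
  agree zero    _      = refl
  agree (suc j) 1+j<ql = trans (coeff-xPowMinusOne k (≤-pred (subst (suc (suc j) ≤_) length-quotient 1+j<ql)))
                               (sym (Φ₁-⊛ (const (+ 1)) (suc j)))

prime⇒>1 : ∀ {r} → Prime r → 1 < r
prime⇒>1 {r} r-prime = nonTrivial⇒n>1 r {{prime⇒nonTrivial r-prime}}

prime⇒∤ : ∀ {r} → Prime r → 1 < d → d < r → ¬ d ∣ r
prime⇒∤ r-prime 1<d d<r d∣r with prime⇒irreducible r-prime d∣r
... | inj₁ refl = <-irrefl refl 1<d
... | inj₂ refl = <-irrefl refl d<r

cyclotomic-prime : ∀ {r} → Prime r → cyclotomic r ≡ replicate r (+ 1)
cyclotomic-prime {r} r-prime = begin
  cyclotomic r                                                   ≡⟨ cyclotomic-nonZero r ⟩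
  divExact (xPowMinusOne (pred r)) (divProd r (table (pred r)))  ≡⟨ cong (divExact (xPowMinusOne (pred r))) below-r ⟩
  divExact (xPowMinusOne (pred r)) Φ₁                            ≡⟨ divExact-xPowMinusOne-Φ₁ (pred r) ⟩
  replicate (suc (pred r)) (+ 1)                                 ≡⟨ cong (λ m → replicate m (+ 1)) (suc-pred r) ⟩
  replicate r (+ 1)                                              ∎
  where
  open ≡-Reasoning
  instance
    r≢0 : NonZero r
    r≢0 = prime⇒nonZero r-prime
  below-r : divProd r (table (pred r)) ≡ Φ₁
  below-r = trans (divProd-table-gap (prime⇒>1 r-prime) (prime⇒∤ r-prime)) (divProd-table-∣ 1 (1∣ r))

indicator : ∀ {A : Set} → Dec A → ℤ
indicator (yes _) = + 1
indicator (no _)  = + 0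

indicator-yes : ∀ {A : Set} (a? : Dec A) → A → indicator a? ≡ + 1
indicator-yes (yes _) _ = refl
indicator-yes (no ¬a) a = contradiction a ¬a

indicator-no : ∀ {A : Set} (a? : Dec A) → ¬ A → indicator a? ≡ + 0
indicator-no (yes a) ¬a = contradiction a ¬a
indicator-no (no _)  _  = refl

0<indicator-indicator : ∀ {A B : Set} (a? : Dec A) (b? : Dec B) →
  (+ 0 ℤ.< indicator a? ℤ.- indicator b?) ⇔ (A × ¬ B)
0<indicator-indicator {A} {B} a? b? = mk⇔ (to a? b?) (from a? b?)
  where
  to : ∀ (a? : Dec A) (b? : Dec B) → + 0 ℤ.< indicator a? ℤ.- indicator b? → A × ¬ B
  to (yes a) (no ¬b) _ = a , ¬b
  to (yes a) (yes b) (+<+ ())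
  to (no ¬a) (yes b) ()
  to (no ¬a) (no ¬b) (+<+ ())
  from : ∀ (a? : Dec A) (b? : Dec B) → A × ¬ B → + 0 ℤ.< indicator a? ℤ.- indicator b?
  from (yes a) (no ¬b) _       = +<+ (s≤s z≤n)
  from a?      (yes b) (_ , ¬b) = contradiction b ¬b
  from (no ¬a) b?      (a , _) = contradiction a ¬a

indicator-indicator<0 : ∀ {A B : Set} (a? : Dec A) (b? : Dec B) →
  (indicator a? ℤ.- indicator b? ℤ.< + 0) ⇔ (¬ A × B)
indicator-indicator<0 {A} {B} a? b? = mk⇔ (to a? b?) (from a? b?)
  where
  to : ∀ (a? : Dec A) (b? : Dec B) → indicator a? ℤ.- indicator b? ℤ.< + 0 → ¬ A × B
  to (no ¬a) (yes b) _ = ¬a , b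
  to (yes a) (yes b) (+<+ ())
  to (yes a) (no ¬b) (+<+ ())
  to (no ¬a) (no ¬b) (+<+ ())
  from : ∀ (a? : Dec A) (b? : Dec B) → ¬ A × B → indicator a? ℤ.- indicator b? ℤ.< + 0
  from (no ¬a) (yes b) _        = -<+
  from (yes a) b?      (¬a , _) = contradiction a ¬a
  from a?      (no ¬b) (_ , b)  = contradiction b ¬b

module _ (p q : ℕ) .{{_ : NonZero p}} .{{_ : NonZero q}} where

  Representable : ℕ → Set
  Representable j = ∃[ i ] ∃[ l ] j ≡ i * p + l * q

  representable? : ∀ j → Dec (Representable j)
  representable? j = map′ forget bound (anyUpTo? (λ i → anyUpTo? (λ l → j ≟ i * p + l * q) (suc j)) (suc j))
    where
    forget : ∃[ i ] i < suc j × ∃[ l ] l < suc j × j ≡ i * p + l * q → Representable j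
    forget (i , _ , l , _ , e) = i , l , e
    bound : Representable j → ∃[ i ] i < suc j × ∃[ l ] l < suc j × j ≡ i * p + l * q
    bound (i , l , e) = i , s≤s i≤j , l , s≤s l≤j , e
      where
      i≤j : i ≤ j
      i≤j = ≤-trans (m≤m*n i p) (≤-trans (m≤m+n (i * p) (l * q)) (≤-reflexive (sym e)))
      l≤j : l ≤ j
      l≤j = ≤-trans (m≤m*n l q) (≤-trans (m≤n+m (l * q) (i * p)) (≤-reflexive (sym e)))

  semigroupSeries : ℕ → ℤ
  semigroupSeries j = indicator (representable? j)

  private
    add-p : ∀ i l {j} → j ≡ i * p + l * q → p + j ≡ suc i * p + l * q
    add-p i l refl = sym (+-assoc p (i * p) (l * q))

    add-q : ∀ i l {j} → j ≡ i * p + l * q → q + j ≡ i * p + suc l * q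
    add-q i l refl = lemma p q i l
      where
      lemma : ∀ p q i l → q + (i * p + l * q) ≡ i * p + (q + l * q)
      lemma = solve-∀

    add-q+p : ∀ i l {j} → j ≡ i * p + l * q → (q + p) + j ≡ suc i * p + suc l * q
    add-q+p i l refl = lemma p q i l
      where
      lemma : ∀ p q i l → (q + p) + (i * p + l * q) ≡ (p + i * p) + (q + l * q)
      lemma = solve-∀

  -- Two representations of j differ by a multiple of (q, -p); below pq that multiple is zero.
  representation-unique-≤ : Coprime p q → ∀ {j i l i′ l′} → j < p * q → i ≤ i′ →
    j ≡ i * p + l * q → j ≡ i′ * p + l′ * q → i ≡ i′
  representation-unique-≤ cop {j} {i} {l} {i′} {l′} j<pq i≤i′ e e′ with i′ ∸ i | m+[n∸m]≡n i≤i′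
  ... | zero  | refl = sym (+-identityʳ i)
  ... | suc t | refl = contradiction j<pq (≤⇒≯ pq≤j)
    where
    lq≡ : l * q ≡ suc t * p + l′ * q
    lq≡ = +-cancelˡ-≡ (i * p) _ _ (trans (sym e) (trans e′ (shift-i i (suc t) p l′ q)))
      where
      shift-i : ∀ i t p l q → (i + t) * p + l * q ≡ i * p + (t * p + l * q)
      shift-i = solve-∀
    q∣t : q ∣ suc t
    q∣t = coprime-divisor (Coprime.sym cop)
            (subst (q ∣_) (*-comm (suc t) p) (∣m+n∣m⇒∣n (subst (q ∣_) (trans lq≡ (+-comm _ (l′ * q))) (n∣m*n l)) (n∣m*n l′)))
    open ≤-Reasoning
    pq≤j : p * q ≤ j
    pq≤j = begin
      p * q                    ≡⟨ *-comm p q ⟩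
      q * p                    ≤⟨ *-monoˡ-≤ p (∣⇒≤ q∣t) ⟩
      suc t * p                ≤⟨ m≤n+m (suc t * p) (i * p) ⟩
      i * p + suc t * p        ≡⟨ *-distribʳ-+ p i (suc t) ⟨
      (i + suc t) * p          ≤⟨ m≤m+n ((i + suc t) * p) (l′ * q) ⟩
      (i + suc t) * p + l′ * q ≡⟨ e′ ⟨
      j                        ∎

  representation-unique : Coprime p q → ∀ {j} → j < p * q →
    ∀ i l → j ≡ i * p + l * q → ∀ i′ l′ → j ≡ i′ * p + l′ * q → i ≡ i′ × l ≡ l′
  representation-unique cop j<pq i l e i′ l′ e′ = i≡i′ , l≡l′
    where
    i≡i′ : i ≡ i′
    i≡i′ with ≤-total i i′
    ... | inj₁ i≤i′ = representation-unique-≤ cop {l = l} {l′ = l′} j<pq i≤i′ e e′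
    ... | inj₂ i′≤i = sym (representation-unique-≤ cop {l = l′} {l′ = l} j<pq i′≤i e′ e)
    l≡l′ : l ≡ l′
    l≡l′ = *-cancelʳ-≡ l l′ q (+-cancelˡ-≡ (i * p) _ _ (trans (sym e) (trans e′ (cong (λ k → k * p + l′ * q) (sym i≡i′)))))

  private
    𝟙 : ℕ → ℤ
    𝟙 = semigroupSeries

    shift-𝟙-yes : ∀ m {j k} → j ≡ m + k → Representable k → shift m 𝟙 j ≡ + 1
    shift-𝟙-yes m {k = k} refl r = trans (shift-+ m 𝟙 k) (indicator-yes (representable? k) r)

    shift-𝟙-no : ∀ m {j} → (∀ {k} → j ≡ m + k → ¬ Representable k) → shift m 𝟙 j ≡ + 0
    shift-𝟙-no m {j} unrep with m ≤? j
    ... | yes m≤j = trans (cong (shift m 𝟙) (sym j≡m+k)) (trans (shift-+ m 𝟙 (j ∸ m)) (indicator-no (representable? _) (unrep (sym j≡m+k))))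
      where
      j≡m+k : m + (j ∸ m) ≡ j
      j≡m+k = m+[n∸m]≡n m≤j
    ... | no m≰j = shift-< m 𝟙 (≰⇒> m≰j)

  doubleDiff-semigroupSeries-0 : doubleDiff p q semigroupSeries 0 ≡ + 1
  doubleDiff-semigroupSeries-0
    rewrite indicator-yes (representable? 0) (0 , 0 , refl)
          | shift-< p 𝟙 (>-nonZero⁻¹ p)
          | shift-< q 𝟙 (>-nonZero⁻¹ q)
          | shift-< (q + p) 𝟙 (<-≤-trans (>-nonZero⁻¹ q) (m≤m+n q p)) = refl

  -- For j = ip + lq < pq the four terms are, by uniqueness, the indicators of true, i ≥ 1, l ≥ 1 and i, l ≥ 1.
  doubleDiff-semigroupSeries : Coprime p q → ∀ {j} → 0 < j → j < p * q → doubleDiff p q semigroupSeries j ≡ + 0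
  doubleDiff-semigroupSeries cop {j} 0<j j<pq with representable? j
  ... | no unrep
    rewrite shift-𝟙-no p       (λ { j≡ (i , l , e) → unrep (suc i , l , trans j≡ (add-p i l e)) })
          | shift-𝟙-no q       (λ { j≡ (i , l , e) → unrep (i , suc l , trans j≡ (add-q i l e)) })
          | shift-𝟙-no (q + p) (λ { j≡ (i , l , e) → unrep (suc i , suc l , trans j≡ (add-q+p i l e)) }) = refl
  ... | yes (zero , zero , j≡0) = contradiction j≡0 (>⇒≢ 0<j)
  ... | yes (suc i , suc l , e)
    rewrite shift-𝟙-yes p       (trans e (sym (add-p i (suc l) refl))) (i , suc l , refl)
          | shift-𝟙-yes q       (trans e (sym (add-q (suc i) l refl))) (suc i , l , refl)
          | shift-𝟙-yes (q + p) (trans e (sym (add-q+p i l refl)))     (i , l , refl) = refl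
  ... | yes (suc i , zero , e)
    rewrite shift-𝟙-yes p (trans e (sym (add-p i zero refl))) (i , zero , refl)
          | shift-𝟙-no q (λ { j≡ (i′ , l′ , e′) →
              0≢1+n (proj₂ (representation-unique cop j<pq (suc i) 0 e i′ (suc l′) (trans j≡ (add-q i′ l′ e′)))) })
          | shift-𝟙-no (q + p) (λ { j≡ (i′ , l′ , e′) →
              0≢1+n (proj₂ (representation-unique cop j<pq (suc i) 0 e (suc i′) (suc l′) (trans j≡ (add-q+p i′ l′ e′)))) }) = refl
  ... | yes (zero , suc l , e)
    rewrite shift-𝟙-no p (λ { j≡ (i′ , l′ , e′) →
              0≢1+n (proj₁ (representation-unique cop j<pq 0 (suc l) e (suc i′) l′ (trans j≡ (add-p i′ l′ e′)))) })
          | shift-𝟙-yes q (trans e (sym (add-q zero l refl))) (zero , l , refl)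
          | shift-𝟙-no (q + p) (λ { j≡ (i′ , l′ , e′) →
              0≢1+n (proj₁ (representation-unique cop j<pq 0 (suc l) e (suc i′) (suc l′) (trans j≡ (add-q+p i′ l′ e′)))) }) = refl

Step : ℕ → ℕ → ℕ → Set
Step d x y = x < y × y ≡ x + d

module _ {d : ℕ} where

  Linked-Step-∈ : ∀ {x xs y} → Linked (Step d) (x ∷ xs) → y ∈ x ∷ xs → ∃[ t ] y ≡ x + t * d
  Linked-Step-∈ {x} _                (here refl) = 0 , sym (+-identityʳ x)
  Linked-Step-∈ {x} ((_ , refl) ∷ ls) (there y∈) with Linked-Step-∈ ls y∈
  ... | t , refl = suc t , +-assoc x d (t * d)

  Linked-Step-fill : ∀ {x xs y} t → Linked (Step d) (x ∷ xs) → y ∈ x ∷ xs → x + t * d ≤ y → x + t * d ∈ x ∷ xs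
  Linked-Step-fill {x} zero    _                 _           _ = here (+-identityʳ x)
  Linked-Step-fill {x} (suc t) _                 (here refl) x+td≤x = here (≤-antisym x+td≤x (m≤m+n x _))
  Linked-Step-fill {x} {_ ∷ xs} {y} (suc t) ((_ , refl) ∷ ls) (there y∈) x+td≤y =
    subst (_∈ x ∷ x + d ∷ xs) (+-assoc x d (t * d)) (there (Linked-Step-fill t ls y∈ (subst (_≤ y) (sym (+-assoc x d (t * d))) x+td≤y)))

InArithProg-progression : ∀ {S : ℕ → Set} b d B .{{_ : NonZero d}} →
  (∀ k → S k ⇔ (∃[ t ] k ≡ b + t * d × t * d ≤ B)) → InArithProg S
InArithProg-progression {S} b d B S⇔ = applyUpTo term (suc (B / d)) , d , (λ k → mk⇔ (to k) (from k)) , applyUpTo⁺₂ term _ step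
  where
  term : ℕ → ℕ
  term t = b + t * d
  step : ∀ t → Step d (term t) (term (suc t))
  step t = +-monoʳ-< b (subst (_< suc t * d) (+-identityˡ (t * d)) (+-monoˡ-< (t * d) (>-nonZero⁻¹ d))) ,
           trans (cong (_+_ b) (+-comm d (t * d))) (sym (+-assoc b (t * d) d))
  to : ∀ k → S k → k ∈ applyUpTo term (suc (B / d))
  to k Sk with Equivalence.to (S⇔ k) Sk
  ... | t , refl , td≤B = ∈-applyUpTo⁺ term (s≤s (subst (_≤ B / d) (m*n/n≡m t d) (/-monoˡ-≤ d td≤B)))
  from : ∀ k → k ∈ applyUpTo term (suc (B / d)) → S k
  from k k∈ with ∈-applyUpTo⁻ term k∈
  ... | t , s≤s t≤B/d , refl = Equivalence.from (S⇔ (term t)) (t , refl , ≤-trans (*-monoˡ-≤ d t≤B/d) (m/n*n≤m B d))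

-- The step divides m and n, hence is 1.
InArithProg-suc-least : ∀ {S : ℕ → Set} {a m n} → InArithProg S → (∀ k → S k → a ≤ k) →
  S a → S (a + m) → S (a + n) → Coprime m n → 1 ≤ m → S (suc a)
InArithProg-suc-least {a = a} ([] , d , S⇔ , ls) _ Sa _ _ _ _ with Equivalence.to (S⇔ a) Sa
... | ()
InArithProg-suc-least {S} {a} {m} (x ∷ xs , d , S⇔ , ls) min Sa Sa+m Sa+n cop 1≤m =
  Equivalence.from (S⇔ (suc a)) (subst (_∈ x ∷ xs) x+d≡1+a (Linked-Step-fill 1 ls (∈xs Sa+m) x+d≤a+m))
  where
  ∈xs : ∀ {k} → S k → k ∈ x ∷ xs
  ∈xs {k} = Equivalence.to (S⇔ k)
  x≡a : x ≡ a
  x≡a with Linked-Step-∈ ls (∈xs Sa)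
  ... | t , a≡x+td = ≤-antisym (subst (x ≤_) (sym a≡x+td) (m≤m+n x (t * d))) (min x (Equivalence.from (S⇔ x) (here refl)))
  d∣offset : ∀ {k} → S (a + k) → d ∣ k
  d∣offset {k} Sa+k with Linked-Step-∈ ls (∈xs Sa+k)
  ... | t , a+k≡x+td = divides t (+-cancelˡ-≡ a k (t * d) (trans a+k≡x+td (cong (_+ t * d) x≡a)))
  d≡1 : d ≡ 1
  d≡1 = cop (d∣offset Sa+m , d∣offset Sa+n)
  x+d≡1+a : x + 1 * d ≡ suc a
  x+d≡1+a = trans (cong₂ (λ u v → u + 1 * v) x≡a d≡1) (+-comm a 1)
  x+d≤a+m : x + 1 * d ≤ a + m
  x+d≤a+m = subst₂ (λ u v → u + 1 * v ≤ a + m) (sym x≡a) (sym d≡1) (+-monoʳ-≤ a 1≤m)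

2∣n⊎2∣1+n : ∀ n → 2 ∣ n ⊎ 2 ∣ suc n
2∣n⊎2∣1+n zero    = inj₁ (divides 0 refl)
2∣n⊎2∣1+n (suc n) = [ (λ { (divides k refl) → inj₂ (divides (suc k) refl) }) , inj₁ ]′ (2∣n⊎2∣1+n n)

odd-prime : ∀ {r} → Prime r → 2 < r → ¬ 2 ∣ r
odd-prime r-prime 2<r 2∣r with prime⇒irreducible r-prime 2∣r
... | inj₂ refl = <-irrefl refl 2<r

private
  absorb-q : ∀ {m p q} i l → q ≡ m * p + 1 → i * p + suc l * q ≡ suc ((i + m) * p + l * q)
  absorb-q {m} {p} i l refl = lemma i l m p
    where
    lemma : ∀ i l m p → i * p + suc l * (m * p + 1) ≡ suc ((i + m) * p + l * (m * p + 1))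
    lemma = solve-∀

  residue-q : ∀ {m p q} i l → q ≡ m * p + 1 → suc (i * p + l * q) ≡ (i + l * m) * p + suc l
  residue-q {m} {p} i l refl = lemma i l m p
    where
    lemma : ∀ i l m p → suc (i * p + l * (m * p + 1)) ≡ (i + l * m) * p + suc l
    lemma = solve-∀

  absorb-q+1 : ∀ {m p q} i l → q + 1 ≡ m * p → suc (i * p + suc l * q) ≡ (i + m) * p + l * q
  absorb-q+1 {m} {p} {q} i l q+1≡mp = begin
    suc (i * p + suc l * q)     ≡⟨ regroup i p l q ⟩
    (i * p + l * q) + (q + 1)   ≡⟨ cong (_+_ (i * p + l * q)) q+1≡mp ⟩
    (i * p + l * q) + m * p     ≡⟨ collect i p l q m ⟩
    (i + m) * p + l * q         ∎
    where
    open ≡-Reasoning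
    regroup : ∀ i p l q → suc (i * p + suc l * q) ≡ (i * p + l * q) + (q + 1)
    regroup = solve-∀
    collect : ∀ i p l q m → (i * p + l * q) + m * p ≡ (i + m) * p + l * q
    collect = solve-∀

  residue-q+1 : ∀ {m p q} t i l → q + 1 ≡ m * p → suc (t * p) ≡ i * p + l * q → t * p + suc l ≡ (i + l * m) * p
  residue-q+1 {m} {p} {q} t i l q+1≡mp e = begin
    t * p + suc l          ≡⟨ +-suc (t * p) l ⟩
    suc (t * p) + l        ≡⟨ cong (_+ l) e ⟩
    (i * p + l * q) + l    ≡⟨ regroup i p l q ⟩
    i * p + l * (q + 1)    ≡⟨ cong (λ r → i * p + l * r) q+1≡mp ⟩
    i * p + l * (m * p)    ≡⟨ collect i p l m ⟩
    (i + l * m) * p        ∎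
    where
    open ≡-Reasoning
    regroup : ∀ i p l q → (i * p + l * q) + l ≡ i * p + l * (q + 1)
    regroup = solve-∀
    collect : ∀ i p l m → i * p + l * (m * p) ≡ (i + l * m) * p
    collect = solve-∀

module _ {p q : ℕ} (p-prime : Prime p) (q-prime : Prime q) (p<q : p < q) where

  private
    instance
      p≢0 : NonZero p
      p≢0 = prime⇒nonZero p-prime
      q≢0 : NonZero q
      q≢0 = prime⇒nonZero q-prime
      pq≢0 : NonZero (p * q)
      pq≢0 = m*n≢0 p q

    1<p : 1 < p
    1<p = prime⇒>1 p-prime

    1≤p : 1 ≤ p
    1≤p = <⇒≤ 1<p

    1≤q : 1 ≤ q
    1≤q = <⇒≤ (≤-<-trans 1≤p p<q)

    coprime : Coprime p q
    coprime = Coprime.sym (prime⇒coprime q-prime p<q)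


  divisors-p*q : d ∣ p * q → d ≡ 1 ⊎ d ≡ p ⊎ d ≡ q ⊎ d ≡ p * q
  divisors-p*q {d} (divides e pq≡ed) with euclidsLemma e d p-prime (subst (p ∣_) pq≡ed (m∣m*n q))
  ... | inj₁ (divides c refl) = [ inj₁ , (λ d≡q → inj₂ (inj₂ (inj₁ d≡q))) ]′ (prime⇒irreducible q-prime (divides c q≡cd))
    where
    q≡cd : q ≡ c * d
    q≡cd = *-cancelˡ-≡ q (c * d) p (trans pq≡ed (trans (*-assoc c p d) (*-comm-middle c p d)))
      where
      *-comm-middle : ∀ a b c → a * (b * c) ≡ b * (a * c)
      *-comm-middle = solve-∀
  ... | inj₂ (divides c refl) = [ (λ c≡1 → inj₂ (inj₁ (trans (cong (_* p) c≡1) (*-identityˡ p))))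
                                , (λ c≡q → inj₂ (inj₂ (inj₂ (trans (cong (_* p) c≡q) (*-comm q p))))) ]′
                                (prime⇒irreducible q-prime (divides e q≡ec))
    where
    q≡ec : q ≡ e * c
    q≡ec = *-cancelˡ-≡ q (e * c) p (trans pq≡ed (trans (sym (*-assoc e c p)) (*-comm (e * c) p)))

  private
    Outside : ℕ → ℕ → ℕ → Set
    Outside a b x = x ≤ a ⊎ b ≤ x

    outside⇒≢ : ∀ {a b x} → Outside a b x → a < d → d < b → d ≢ x
    outside⇒≢ (inj₁ x≤a) a<d d<b refl = <⇒≱ a<d x≤a
    outside⇒≢ (inj₂ b≤x) a<d d<b refl = <⇒≱ d<b b≤x

    no-divisor-between : ∀ {a b} → Outside a b 1 → Outside a b p → Outside a b q → Outside a b (p * q) →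
      a < d → d < b → ¬ d ∣ p * q
    no-divisor-between out-1 out-p out-q out-pq a<d d<b d∣pq with divisors-p*q d∣pq
    ... | inj₁ d≡1                 = outside⇒≢ out-1 a<d d<b d≡1
    ... | inj₂ (inj₁ d≡p)          = outside⇒≢ out-p a<d d<b d≡p
    ... | inj₂ (inj₂ (inj₁ d≡q))   = outside⇒≢ out-q a<d d<b d≡q
    ... | inj₂ (inj₂ (inj₂ d≡pq))  = outside⇒≢ out-pq a<d d<b d≡pq

  -- The divisors of pq below pq are 1, p and q.
  divProd-table-p*q : divProd (p * q) (table (pred (p * q))) ≡ mulP (replicate q (+ 1)) (mulP (replicate p (+ 1)) Φ₁)
  divProd-table-p*q = begin
    divProd (p * q) (table (pred (p * q)))                 ≡⟨ divProd-table-gap q<pq above-q ⟩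
    divProd (p * q) (table q)                              ≡⟨ divProd-table-∣ q (n∣m*n p) ⟩
    mulP Φq (divProd (p * q) (table (pred q)))             ≡⟨ cong (mulP Φq) (divProd-table-gap p<q between-p-q) ⟩
    mulP Φq (divProd (p * q) (table p))                    ≡⟨ cong (mulP Φq) (divProd-table-∣ p (m∣m*n q)) ⟩
    mulP Φq (mulP Φp (divProd (p * q) (table (pred p))))   ≡⟨ cong (mulP Φq ∘ mulP Φp) (divProd-table-gap 1<p between-1-p) ⟩
    mulP Φq (mulP Φp (divProd (p * q) (table 1)))          ≡⟨ cong (mulP Φq ∘ mulP Φp) (divProd-table-∣ 1 (1∣ (p * q))) ⟩
    mulP Φq (mulP Φp Φ₁)                                   ≡⟨ cong₂ (λ f g → mulP f (mulP g Φ₁)) (cyclotomic-prime q-prime) (cyclotomic-prime p-prime) ⟩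
    mulP (replicate q (+ 1)) (mulP (replicate p (+ 1)) Φ₁) ∎
    where
    open ≡-Reasoning
    Φp Φq : Poly
    Φp = cyclotomic p
    Φq = cyclotomic q
    q<pq : q < p * q
    q<pq = <-≤-trans (m<m*n q p 1<p) (≤-reflexive (*-comm q p))
    q≤pq : q ≤ p * q
    q≤pq = <⇒≤ q<pq
    above-q : ∀ {d} → q < d → d < p * q → ¬ d ∣ p * q
    above-q = no-divisor-between (inj₁ 1≤q) (inj₁ (<⇒≤ p<q)) (inj₁ ≤-refl) (inj₂ ≤-refl)
    between-p-q : ∀ {d} → p < d → d < q → ¬ d ∣ p * q
    between-p-q = no-divisor-between (inj₁ 1≤p) (inj₁ ≤-refl) (inj₂ ≤-refl) (inj₂ q≤pq)
    between-1-p : ∀ {d} → 1 < d → d < p → ¬ d ∣ p * q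
    between-1-p = no-divisor-between (inj₁ ≤-refl) (inj₂ ≤-refl) (inj₂ (<⇒≤ p<q)) (inj₂ (≤-trans (<⇒≤ p<q) q≤pq))

  degree : ℕ
  degree = pred p * pred q

  1+pq≡degree+q+p : suc (p * q) ≡ degree + (q + p)
  1+pq≡degree+q+p = subst₂ (λ x y → suc (x * y) ≡ pred x * pred y + (y + x)) (suc-pred p) (suc-pred q) (expand (pred p) (pred q))
    where
    expand : ∀ a b → suc (suc a * suc b) ≡ a * b + (suc b + suc a)
    expand = solve-∀

  degree<pq : degree < p * q
  degree<pq = +-cancelʳ-< (q + p) degree (p * q) (begin
    suc (degree + (q + p)) ≡⟨ cong suc 1+pq≡degree+q+p ⟨
    2 + p * q            ≤⟨ +-monoˡ-≤ (p * q) (+-mono-≤ (>-nonZero⁻¹ q) (>-nonZero⁻¹ p)) ⟩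
    (q + p) + p * q      ≡⟨ +-comm (q + p) (p * q) ⟩
    p * q + (q + p)      ∎)
    where open ≤-Reasoning

  private
    𝟙 : ℕ → ℤ
    𝟙 = semigroupSeries p q
    Rp Rq numerator denominator : Poly
    Rp = replicate p (+ 1)
    Rq = replicate q (+ 1)
    numerator = xPowMinusOne (pred (p * q))
    denominator = mulP Rq (mulP Rp Φ₁)

    numerator≡ : ∀ j → j < p * q → coeff numerator j ≡ ℤ.- doubleDiff p q 𝟙 j
    numerator≡ zero    _      = sym (cong ℤ.-_ (doubleDiff-semigroupSeries-0 p q))
    numerator≡ (suc j) 1+j<pq = trans (coeff-xPowMinusOne (pred (p * q)) (<⇒≤pred 1+j<pq))
      (sym (cong ℤ.-_ (doubleDiff-semigroupSeries p q coprime (s≤s z≤n) 1+j<pq)))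

    length-Rp-Φ₁ : length (mulP Rp Φ₁) ≡ suc p
    length-Rp-Φ₁ = suc-injective (trans (length-replicate-mulP (+ 1) Φ₁ 1≤p (s≤s z≤n)) (+-comm p 2))

    length-denominator : length denominator ≡ q + p
    length-denominator = suc-injective (begin
      suc (length denominator) ≡⟨ length-replicate-mulP (+ 1) (mulP Rp Φ₁) 1≤q 1≤∣Rp-Φ₁∣ ⟩
      q + length (mulP Rp Φ₁)  ≡⟨ cong (_+_ q) length-Rp-Φ₁ ⟩
      q + suc p                ≡⟨ +-suc q p ⟩
      suc (q + p)              ∎)
      where
      open ≡-Reasoning
      1≤∣Rp-Φ₁∣ : 1 ≤ length (mulP Rp Φ₁)
      1≤∣Rp-Φ₁∣ = subst (1 ≤_) (sym length-Rp-Φ₁) (s≤s z≤n)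

    length-numerator : length numerator ≡ suc (p * q)
    length-numerator = trans (length-xPowMinusOne (pred (p * q))) (cong suc (suc-pred (p * q)))

    quotientLength≡ : quotientLength numerator denominator ≡ suc degree
    quotientLength≡ = cong suc (begin
      length numerator ∸ length denominator ≡⟨ cong₂ _∸_ length-numerator length-denominator ⟩
      suc (p * q) ∸ (q + p)                 ≡⟨ cong (_∸ (q + p)) 1+pq≡degree+q+p ⟩
      degree + (q + p) ∸ (q + p)            ≡⟨ m+n∸n≡m degree (q + p) ⟩
      degree                                ∎)
      where open ≡-Reasoning

    coeff-denominator-0 : coeff denominator 0 ≡ -[1+ 0 ]
    coeff-denominator-0
      rewrite coeff-mulP-0 Rq (mulP Rp Φ₁) | coeff-mulP-0 Rp Φ₁
            | coeff-replicate-0 (+ 1) 1≤q | coeff-replicate-0 (+ 1) 1≤p = refl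

    denominator-⊛-diff : ∀ {j} → j < p * q → coeff numerator j ≡ (denominator ⊛ diff 𝟙) j
    denominator-⊛-diff {j} j<pq = trans (numerator≡ j j<pq) (sym (begin
      (denominator ⊛ diff 𝟙) j          ≡⟨ mulP-⊛ Rq (mulP Rp Φ₁) (diff 𝟙) j ⟩
      (Rq ⊛ (mulP Rp Φ₁ ⊛ diff 𝟙)) j    ≡⟨ ⊛-congʳ Rq (mulP-⊛ Rp Φ₁ (diff 𝟙)) j ⟩
      (Rq ⊛ (Rp ⊛ (Φ₁ ⊛ diff 𝟙))) j     ≡⟨ ones-ones-Φ₁-⊛-diff p q 𝟙 j ⟩
      ℤ.- doubleDiff p q 𝟙 j            ∎))
      where open ≡-Reasoning

  cyclotomic-p*q : cyclotomic (p * q) ≡ applyUpTo (diff (semigroupSeries p q)) (suc degree)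
  cyclotomic-p*q = begin
    cyclotomic (p * q)                                          ≡⟨ cyclotomic-nonZero (p * q) ⟩
    divExact numerator (divProd (p * q) (table (pred (p * q)))) ≡⟨ cong (divExact numerator) divProd-table-p*q ⟩
    divExact numerator denominator                              ≡⟨ divExact-correct numerator denominator (diff 𝟙) unit agree ⟩
    applyUpTo (diff 𝟙) (quotientLength numerator denominator)   ≡⟨ cong (applyUpTo (diff 𝟙)) quotientLength≡ ⟩
    applyUpTo (diff 𝟙) (suc degree)                             ∎
    where
    open ≡-Reasoning
    unit : coeff denominator 0 ℤ.* coeff denominator 0 ≡ + 1
    unit = cong (λ c → c ℤ.* c) coeff-denominator-0
    agree : ∀ j → j < quotientLength numerator denominator → coeff numerator j ≡ (denominator ⊛ diff 𝟙) j
    agree j j<ql = denominator-⊛-diff (≤-trans (subst (j <_) quotientLength≡ j<ql) degree<pq)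

  cycCoeff-≤ : ∀ {k} → k ≤ degree → cycCoeff (p * q) k ≡ diff (semigroupSeries p q) k
  cycCoeff-≤ {k} k≤degree = trans (cong (λ f → coeff f k) cyclotomic-p*q) (coeff-applyUpTo-< (diff 𝟙) (s≤s k≤degree))

  cycCoeff-> : ∀ {k} → degree < k → cycCoeff (p * q) k ≡ + 0
  cycCoeff-> {k} degree<k = trans (cong (λ f → coeff f k) cyclotomic-p*q) (coeff-applyUpTo-≥ (diff 𝟙) degree<k)

  cycCoeff-0 : cycCoeff (p * q) 0 ≡ + 1
  cycCoeff-0 = trans (cycCoeff-≤ z≤n) (cong (ℤ._- + 0) (indicator-yes (representable? p q 0) (0 , 0 , refl)))

  Splus-0 : Splus (p * q) 0
  Splus-0 = subst (+ 0 ℤ.<_) (sym cycCoeff-0) (ℤ.+<+ (s≤s z≤n))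

  ¬Sminus-0 : ¬ Sminus (p * q) 0
  ¬Sminus-0 c₀<0 = ℤₚ.<-asym c₀<0 (subst (+ 0 ℤ.<_) (sym cycCoeff-0) (ℤ.+<+ (s≤s z≤n)))

  private
    ≤degree : ∀ {k} → (cycCoeff (p * q) k ≢ + 0) → k ≤ degree
    ≤degree {k} c≢0 with k ≤? degree
    ... | yes k≤degree = k≤degree
    ... | no  k≰degree = contradiction (cycCoeff-> (≰⇒> k≰degree)) c≢0

  Splus⇒≤degree : ∀ {k} → Splus (p * q) k → k ≤ degree
  Splus⇒≤degree 0<c = ≤degree (λ c≡0 → ℤₚ.<-irrefl (sym c≡0) 0<c)

  Sminus⇒≤degree : ∀ {k} → Sminus (p * q) k → k ≤ degree
  Sminus⇒≤degree c<0 = ≤degree (λ c≡0 → ℤₚ.<-irrefl c≡0 c<0)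

  Splus-suc : ∀ {k} → suc k ≤ degree →
    Splus (p * q) (suc k) ⇔ (Representable p q (suc k) × ¬ Representable p q k)
  Splus-suc {k} 1+k≤degree =
    subst (λ c → (+ 0 ℤ.< c) ⇔ (Representable p q (suc k) × ¬ Representable p q k)) (sym (cycCoeff-≤ 1+k≤degree))
      (0<indicator-indicator (representable? p q (suc k)) (representable? p q k))

  Sminus-suc : ∀ {k} → suc k ≤ degree →
    Sminus (p * q) (suc k) ⇔ (¬ Representable p q (suc k) × Representable p q k)
  Sminus-suc {k} 1+k≤degree =
    subst (λ c → (c ℤ.< + 0) ⇔ (¬ Representable p q (suc k) × Representable p q k)) (sym (cycCoeff-≤ 1+k≤degree))
      (indicator-indicator<0 (representable? p q (suc k)) (representable? p q k))

  module _ (2<p : 2 < p) where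

    private
      Rep : ℕ → Set
      Rep = Representable p q

      2≤p′ : 2 ≤ pred p
      2≤p′ = <⇒≤pred 2<p

      2≤q′ : 2 ≤ pred q
      2≤q′ = <⇒≤pred (<-trans 2<p p<q)

      q′<q : pred q < q
      q′<q = ≤-reflexive (suc-pred q)

      1+q≤degree : suc q ≤ degree
      1+q≤degree = begin
        suc q               ≡⟨ cong suc (suc-pred q) ⟨
        2 + pred q          ≤⟨ +-monoˡ-≤ (pred q) 2≤q′ ⟩
        pred q + pred q     ≡⟨ cong (_+_ (pred q)) (+-identityʳ (pred q)) ⟨
        2 * pred q          ≤⟨ *-monoˡ-≤ (pred q) 2≤p′ ⟩
        pred p * pred q     ∎
        where open ≤-Reasoning

      degree<p′q : degree < pred p * q
      degree<p′q = *-monoʳ-< (pred p) {{>-nonZero (≤-trans (s≤s z≤n) 2≤p′)}} q′<q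

      rep-0 : Rep 0
      rep-0 = 0 , 0 , refl

      rep-p : Rep p
      rep-p = 1 , 0 , sym (trans (+-identityʳ (1 * p)) (*-identityˡ p))

      rep-q : Rep q
      rep-q = 0 , 1 , sym (*-identityˡ q)

      p≤rep : ∀ {j} i l → j ≡ suc i * p + l * q → p ≤ j
      p≤rep i l refl = ≤-trans (m≤m+n p (i * p)) (m≤m+n (suc i * p) (l * q))

      q≤rep : ∀ {j} i l → j ≡ i * p + suc l * q → q ≤ j
      q≤rep i l refl = ≤-trans (m≤m+n q (l * q)) (m≤n+m (suc l * q) (i * p))

      ¬rep-below-p : ∀ {j} → 0 < j → j < p → ¬ Rep j
      ¬rep-below-p 0<j j<p (zero  , zero  , j≡0) = <-irrefl (sym j≡0) 0<j
      ¬rep-below-p 0<j j<p (suc i , l     , e)   = <⇒≱ j<p (p≤rep i l e)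
      ¬rep-below-p 0<j j<p (zero  , suc l , e)   = <⇒≱ (<-trans j<p p<q) (q≤rep 0 l e)

      ¬rep-1 : ¬ Rep 1
      ¬rep-1 = ¬rep-below-p (s≤s z≤n) 1<p

      rep-below-q : ∀ {j} → j < q → ∀ i l → j ≡ i * p + l * q → l ≡ 0
      rep-below-q j<q i zero    _ = refl
      rep-below-q j<q i (suc l) e = contradiction (q≤rep i l e) (<⇒≱ j<q)

      -- p + 1 = q is ruled out by parity.
      ¬rep-1+p : ¬ Rep (suc p)
      ¬rep-1+p (i , zero , e) = <-irrefl (sym p≡1) 1<p
        where
        p≡1 : p ≡ 1
        p≡1 = ∣1⇒≡1 (∣m+n∣m⇒∣n (divides i (trans (+-comm p 1) (trans e (+-identityʳ (i * p))))) ∣-refl)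
      ¬rep-1+p (i , suc l , e) with ≤-antisym (q≤rep i l e) p<q
      ... | refl = [ odd-prime p-prime 2<p , odd-prime q-prime (<-trans 2<p p<q) ]′ (2∣n⊎2∣1+n p)

      p∣1+l⇒large : ∀ {k} i l → p ∣ suc l → k ≡ i * p + l * q → pred p * q ≤ k
      p∣1+l⇒large i l p∣1+l refl = ≤-trans (*-monoˡ-≤ q (≤-pred (subst (_≤ suc l) (sym (suc-pred p)) (∣⇒≤ p∣1+l)))) (m≤n+m (l * q) (i * p))

      instance
        degree≢0 : NonZero degree
        degree≢0 = >-nonZero (≤-trans (s≤s z≤n) 1+q≤degree)

      Splus-intro : ∀ {k} → 1 ≤ k → k ≤ degree → Rep k → ¬ Rep (pred k) → Splus (p * q) k
      Splus-intro {suc k} _ 1+k≤degree rep ¬rep = Equivalence.from (Splus-suc 1+k≤degree) (rep , ¬rep)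

      Sminus-intro : ∀ {k} → suc k ≤ degree → ¬ Rep (suc k) → Rep k → Sminus (p * q) (suc k)
      Sminus-intro 1+k≤degree ¬rep rep = Equivalence.from (Sminus-suc 1+k≤degree) (¬rep , rep)

      Splus-p : Splus (p * q) p
      Splus-p = Splus-intro 1≤p (≤-trans (<⇒≤ p<q) (≤-trans (n≤1+n q) 1+q≤degree)) rep-p
                  (¬rep-below-p (≤-trans (s≤s z≤n) 2≤p′) (≤-reflexive (suc-pred p)))

      Sminus-1 : Sminus (p * q) 1
      Sminus-1 = Sminus-intro (≤-trans (s≤s z≤n) 1+q≤degree) ¬rep-1 rep-0

      Sminus-1+p : Sminus (p * q) (suc p)
      Sminus-1+p = Sminus-intro (≤-trans p<q (≤-trans (n≤1+n q) 1+q≤degree)) ¬rep-1+p rep-p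

    Splus-progression⇒q≡mp+1 : InArithProg (Splus (p * q)) → ∃[ m ] (1 ≤ m × q ≡ m * p + 1)
    Splus-progression⇒q≡mp+1 ap with representable? p q (pred q)
    ... | no ¬rep = contradiction rep-0 (proj₂ (Equivalence.to (Splus-suc 1≤degree) Splus-1))
      where
      1≤degree : 1 ≤ degree
      1≤degree = ≤-trans (s≤s z≤n) 1+q≤degree
      Splus-q : Splus (p * q) q
      Splus-q = Splus-intro 1≤q (≤-trans (n≤1+n q) 1+q≤degree) rep-q ¬rep
      Splus-1 : Splus (p * q) 1
      Splus-1 = InArithProg-suc-least ap (λ _ _ → z≤n) Splus-0 Splus-p Splus-q coprime 1≤p
    ... | yes (zero , l , e) = contradiction (trans e (cong (_* q) (rep-below-q q′<q 0 l e))) (>⇒≢ (≤-trans (s≤s z≤n) 2≤q′))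
    ... | yes (suc i , l , e) with rep-below-q q′<q (suc i) l e
    ... | refl = suc i , s≤s z≤n , trans (sym (suc-pred q)) (trans (cong suc (trans e (+-identityʳ (suc i * p)))) (+-comm 1 (suc i * p)))

    q≡mp+1⇒Splus-progression : ∃[ m ] (1 ≤ m × q ≡ m * p + 1) → InArithProg (Splus (p * q))
    q≡mp+1⇒Splus-progression (m , _ , q≡mp+1) = InArithProg-progression 0 p degree (λ k → mk⇔ (to k) (from k))
      where
      to : ∀ k → Splus (p * q) k → ∃[ t ] k ≡ 0 + t * p × t * p ≤ degree
      to zero    _        = 0 , refl , z≤n
      to (suc k) Splus-1+k = multiple (Equivalence.to (Splus-suc 1+k≤degree) Splus-1+k)
        where
        1+k≤degree : suc k ≤ degree
        1+k≤degree = Splus⇒≤degree Splus-1+k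
        multiple : Rep (suc k) × ¬ Rep k → ∃[ t ] suc k ≡ 0 + t * p × t * p ≤ degree
        multiple ((i , zero , e) , _) = i , 1+k≡ip , subst (_≤ degree) 1+k≡ip 1+k≤degree
          where
          1+k≡ip : suc k ≡ i * p
          1+k≡ip = trans e (+-identityʳ (i * p))
        multiple ((i , suc l , e) , ¬rep) = contradiction (i + m , l , suc-injective (trans e (absorb-q i l q≡mp+1))) ¬rep
      from : ∀ k → ∃[ t ] k ≡ 0 + t * p × t * p ≤ degree → Splus (p * q) k
      from _ (zero  , refl , _)      = Splus-0
      from _ (suc t , refl , k≤degree) = Splus-intro 1≤k k≤degree (suc t , 0 , sym (+-identityʳ (suc t * p))) ¬rep-pred
        where
        k : ℕ
        k = suc t * p
        1≤k : 1 ≤ k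
        1≤k = ≤-trans 1≤p (m≤m+n p (t * p))
        ¬rep-pred : ¬ Rep (pred k)
        ¬rep-pred (i , l , e) = <⇒≱ (<-trans (<-≤-trans pred-k<k k≤degree) degree<p′q) (p∣1+l⇒large i l p∣1+l e)
          where
          pred-k<k : pred k < k
          pred-k<k = ≤-reflexive (suc-pred k {{>-nonZero 1≤k}})
          p∣1+l : p ∣ suc l
          p∣1+l = ∣m+n∣m⇒∣n (divides (suc t) (trans (sym (residue-q i l q≡mp+1)) (trans (cong suc (sym e)) (suc-pred k {{>-nonZero 1≤k}}))))
                            (n∣m*n (i + l * m))

    Sminus-progression⇒q+1≡mp : InArithProg (Sminus (p * q)) → ∃[ m ] (1 ≤ m × q + 1 ≡ m * p)
    Sminus-progression⇒q+1≡mp ap with representable? p q (suc q)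
    ... | no ¬rep = contradiction (proj₂ (Equivalence.to (Sminus-suc 2≤degree) Sminus-2)) ¬rep-1
      where
      2≤degree : 2 ≤ degree
      2≤degree = ≤-trans (s≤s 1≤q) 1+q≤degree
      1≤ : ∀ k → Sminus (p * q) k → 1 ≤ k
      1≤ zero    Sminus-0 = contradiction Sminus-0 (¬Sminus-0)
      1≤ (suc k) _        = s≤s z≤n
      Sminus-1+q : Sminus (p * q) (suc q)
      Sminus-1+q = Sminus-intro 1+q≤degree ¬rep rep-q
      Sminus-2 : Sminus (p * q) 2
      Sminus-2 = InArithProg-suc-least ap 1≤ Sminus-1 Sminus-1+p Sminus-1+q coprime 1≤p
    ... | yes (zero  , zero , ())
    ... | yes (suc i , zero , e) = suc i , s≤s z≤n , trans (+-comm q 1) (trans e (+-identityʳ (suc i * p)))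
    ... | yes (i , suc zero , e) = contradiction p≡1 (>⇒≢ 1<p)
      where
      ip≡1 : i * p ≡ 1
      ip≡1 = +-cancelʳ-≡ q (i * p) 1 (trans (cong (_+_ (i * p)) (sym (+-identityʳ q))) (sym e))
      p≡1 : p ≡ 1
      p≡1 = m*n≡1⇒n≡1 i p ip≡1
    ... | yes (i , suc (suc l) , e) = contradiction 2q≤1+q (<⇒≱ (subst (_< q + q) (+-comm q 1) (+-monoʳ-< q 1<q)))
      where
      1<q : 1 < q
      1<q = <-trans 1<p p<q
      2q≤1+q : q + q ≤ suc q
      2q≤1+q = ≤-trans (+-monoʳ-≤ q (m≤m+n q (l * q))) (≤-trans (m≤n+m (suc (suc l) * q) (i * p)) (≤-reflexive (sym e)))

    q+1≡mp⇒Sminus-progression : ∃[ m ] (1 ≤ m × q + 1 ≡ m * p) → InArithProg (Sminus (p * q))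
    q+1≡mp⇒Sminus-progression (m , _ , q+1≡mp) = InArithProg-progression 1 p (pred degree) (λ k → mk⇔ (to k) (from k))
      where
      to : ∀ k → Sminus (p * q) k → ∃[ t ] k ≡ 1 + t * p × t * p ≤ pred degree
      to zero    Sminus-0   = contradiction Sminus-0 (¬Sminus-0)
      to (suc k) Sminus-1+k = multiple (Equivalence.to (Sminus-suc 1+k≤degree) Sminus-1+k)
        where
        1+k≤degree : suc k ≤ degree
        1+k≤degree = Sminus⇒≤degree Sminus-1+k
        multiple : ¬ Rep (suc k) × Rep k → ∃[ t ] suc k ≡ 1 + t * p × t * p ≤ pred degree
        multiple (_ , (i , zero , e)) = i , cong suc k≡ip , subst (_≤ pred degree) k≡ip (suc[m]≤n⇒m≤pred[n] 1+k≤degree)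
          where
          k≡ip : k ≡ i * p
          k≡ip = trans e (+-identityʳ (i * p))
        multiple (¬rep , (i , suc l , e)) = contradiction (i + m , l , trans (cong suc e) (absorb-q+1 i l q+1≡mp)) ¬rep
      from : ∀ k → ∃[ t ] k ≡ 1 + t * p × t * p ≤ pred degree → Sminus (p * q) k
      from _ (t , refl , tp≤pred-degree) = Sminus-intro 1+tp≤degree ¬rep (t , 0 , sym (+-identityʳ (t * p)))
        where
        1+tp≤degree : suc (t * p) ≤ degree
        1+tp≤degree = m≤pred[n]⇒suc[m]≤n tp≤pred-degree
        ¬rep : ¬ Rep (suc (t * p))
        ¬rep (i , l , e) = <⇒≱ (≤-<-trans 1+tp≤degree degree<p′q) (p∣1+l⇒large i l p∣1+l e)
          where
          p∣1+l : p ∣ suc l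
          p∣1+l = ∣m+n∣m⇒∣n (divides (i + l * m) (residue-q+1 t i l q+1≡mp e)) (n∣m*n t)

corollary1p5 : (p q : ℕ) → Prime p → Prime q → 2 < p → p < q →
    (InArithProg (Splus (p * q)) ⇔ (∃[ m ] (1 ≤ m × q ≡ m * p + 1)))
    × (InArithProg (Sminus (p * q)) ⇔ (∃[ m ] (1 ≤ m × q + 1 ≡ m * p)))
corollary1p5 p q p-prime q-prime 2<p p<q =
  mk⇔ (Splus-progression⇒q≡mp+1 p-prime q-prime p<q 2<p) (q≡mp+1⇒Splus-progression p-prime q-prime p<q 2<p) ,
  mk⇔ (Sminus-progression⇒q+1≡mp p-prime q-prime p<q 2<p) (q+1≡mp⇒Sminus-progression p-prime q-prime p<q 2<p)
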